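{- A sequence $\mathbf{x}$ over a finite alphabet is eventually periodic if and only if both sequences $(r_{\mathbf{x}}(2n))_{n\ge 0}$ and $(r_{\mathbf{x}}(2n+1))_{n\ge 0}$ are eventually constant.
   Context: A factor of a sequence is a finite contiguous block. For a finite word $u=u(1)\cdots u(m)$, its reversal is $u^R=u(m)\cdots u(1)$; $u$ and $v$ are reflectively equivalent if $v=u$ or $v=u^R$. The reflection complexity $r_{\mathbf{x}}(n)$ is the number of distinct length-$n$ factors of $\mathbf{x}$ up to reflective equivalence. $\mathbf{x}$ is eventually periodic if $\mathbf{x}=uv^\omega$ for finite words $u,v$ with $v$ nonempty. -}

module Defs where

open import Data.Nat using (ℕ; zero; suc; _+_; _*_; _∸_; _≥_; _<?_)
open import Data.Nat.DivMod using (_mod_)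
open import Data.Fin using (Fin; toℕ; fromℕ<)
open import Data.Vec using (Vec; lookup; tabulate; reverse)
open import Data.Product using (Σ; ∃; _×_; _,_)
open import Data.Sum using (_⊎_)
open import Relation.Nullary using (¬_; yes; no)
open import Relation.Binary.PropositionalEquality using (_≡_; _≢_)

Seq : ℕ → Set
Seq k = ℕ → Fin k

uvω : ∀ {A : Set} {m p : ℕ} → Vec A m → Vec A (suc p) → ℕ → A
uvω {m = m} {p} u v i with i <? m
... | yes i<m = lookup u (fromℕ< i<m)
... | no  _   = lookup v ((i ∸ m) mod (suc p))

EventuallyPeriodic : ∀ {k} → Seq k → Set
EventuallyPeriodic {k} x =
  Σ ℕ λ m → Σ ℕ λ p → Σ (Vec (Fin k) m) λ u → Σ (Vec (Fin k) (suc p)) λ v →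
    ∀ i → x i ≡ uvω u v i

factorAt : ∀ {k} → Seq k → ℕ → (n : ℕ) → Vec (Fin k) n
factorAt x i n = tabulate (λ j → x (i + toℕ j))

IsFactor : ∀ {k} → Seq k → {n : ℕ} → Vec (Fin k) n → Set
IsFactor x {n} w = ∃ λ i → factorAt x i n ≡ w

ReflEq : ∀ {A : Set} {n} → Vec A n → Vec A n → Set
ReflEq u v = v ≡ u ⊎ v ≡ reverse u

-- HasReflComplexity x n c  :  r_x(n) = c, i.e. there is a list of c
-- length-n factors of x, pairwise not reflectively equivalent, such that
-- every length-n factor of x is reflectively equivalent to one of them.
-- (This relation is functional in c.)
HasReflComplexity : ∀ {k} → Seq k → ℕ → ℕ → Set
HasReflComplexity {k} x n c =
  Σ (Vec (Vec (Fin k) n) c) λ ws →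
      (∀ j → IsFactor x (lookup ws j))
    × (∀ j j′ → j ≢ j′ → ¬ ReflEq (lookup ws j) (lookup ws j′))
    × (∀ i → ∃ λ j → ReflEq (factorAt x i n) (lookup ws j))

EventuallyConstantRC : ∀ {k} → Seq k → (ℕ → ℕ) → Set
EventuallyConstantRC x f =
  Σ ℕ λ c → Σ ℕ λ N → ∀ n → n ≥ N → HasReflComplexity x (f n) c

{-# OPTIONS --safe #-}
-- If x has period P from its least preperiod m on, send a starting position a to
-- φ a = a when a < m and to a + P − 1 otherwise. For n ≥ 2m + P this matches the
-- length-n factors with the length-(n + 2) factors class by class. A factor starting
-- before m is neither a mirror image of a factor nor a copy of one starting at or after m
-- (either would make x periodic from an earlier position), and whether two such factors
-- coincide no longer depends on n. A periodic factor, moved back one step in the period,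
-- gains one letter at each end, which preserves both equality and reversal.
-- Hence r_x(n + 2) = r_x(n) for large n.
-- Conversely, if r_x(2n) = c for large n, then two of the length-2n factors starting at
-- 0, …, 2c coincide, since each class contains at most two words. Such repetitions exist
-- for every length with start and period bounded by 2c, and a long one then extends letter
-- by letter through longer ones, so x is periodic from its start.
module Submission where

open import Defs
open import Data.Nat using (ℕ; zero; suc; _+_; _*_; _∸_; _≤_; _<_; _≥_; s≤s; s≤s⁻¹; z<s; _<?_)
open import Data.Nat.Properties
open import Data.Nat.Tactic.RingSolver using (solve)
open import Data.Nat.DivMod using (_mod_; _%_; _/_; m%n<n; m≡m%n+[m/n]*n; [m+n]%n≡m%n)
open import Data.Fin as Fin using (Fin; toℕ; fromℕ; fromℕ<; inject₁; opposite; join; splitAt)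
open import Data.Fin.Properties
  using (fromℕ<-cong; toℕ-fromℕ<; toℕ<n; opposite-prop; opposite-involutive; any?; pigeonhole; splitAt-join)
  renaming (_≟_ to _≟ᶠ_)
open import Data.List.Base using ([]; _∷_)
open import Data.Vec using (Vec; lookup; tabulate; reverse; _∷ʳ_)
open import Data.Vec.Properties
  using (reverse-∷; reverse-reverse; reverse-injective; lookup∘tabulate; tabulate∘lookup; tabulate-cong; ≡-dec)
open import Data.Product using (∃; ∃₂; _×_; _,_; proj₁; proj₂)
open import Data.Sum using (_⊎_; inj₁; inj₂; [_,_])
open import Data.Sum.Function.Propositional using (_⊎-⇔_)
open import Data.Empty using (⊥-elim)
open import Function using (_∘_; _⇔_; mk⇔; Equivalence)
import Function.Properties.Equivalence as ⇔
open import Relation.Binary.Definitions using (DecidableEquality; Decidable)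
open import Relation.Binary.PropositionalEquality using (_≡_; _≢_; refl; sym; trans; cong; subst; subst₂; module ≡-Reasoning)
open import Relation.Nullary using (¬_; yes; no)
open import Relation.Nullary.Decidable using (_⊎-dec_)

module _ {A : Set} where
  -- Elsewhere [] and _∷_ are the list constructors, as the ring solver expects.
  open import Data.Vec using ([]; _∷_)

  lookup-∷ʳ-inject₁ : ∀ {n} (xs : Vec A n) y i → lookup (xs ∷ʳ y) (inject₁ i) ≡ lookup xs i
  lookup-∷ʳ-inject₁ (x ∷ xs) y Fin.zero    = refl
  lookup-∷ʳ-inject₁ (x ∷ xs) y (Fin.suc i) = lookup-∷ʳ-inject₁ xs y i

  lookup-∷ʳ-last : ∀ {n} (xs : Vec A n) y → lookup (xs ∷ʳ y) (fromℕ n) ≡ y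
  lookup-∷ʳ-last []       y = refl
  lookup-∷ʳ-last (x ∷ xs) y = lookup-∷ʳ-last xs y

  lookup-reverse-opposite : ∀ {n} (xs : Vec A n) i → lookup (reverse xs) (opposite i) ≡ lookup xs i
  lookup-reverse-opposite (x ∷ xs) Fin.zero rewrite reverse-∷ x xs = lookup-∷ʳ-last (reverse xs) x
  lookup-reverse-opposite (x ∷ xs) (Fin.suc i) rewrite reverse-∷ x xs =
    trans (lookup-∷ʳ-inject₁ (reverse xs) x (opposite i)) (lookup-reverse-opposite xs i)

  lookup-reverse : ∀ {n} (xs : Vec A n) i → lookup (reverse xs) i ≡ lookup xs (opposite i)
  lookup-reverse xs i = begin
    lookup (reverse xs) i                       ≡⟨ cong (lookup (reverse xs)) (opposite-involutive i) ⟨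
    lookup (reverse xs) (opposite (opposite i)) ≡⟨ lookup-reverse-opposite xs (opposite i) ⟩
    lookup xs (opposite i)                      ∎
    where open ≡-Reasoning

  ReflEq-refl : ∀ {n} {u : Vec A n} → ReflEq u u
  ReflEq-refl = inj₁ refl

  ReflEq-sym : ∀ {n} {u v : Vec A n} → ReflEq u v → ReflEq v u
  ReflEq-sym (inj₁ v≡u)         = inj₁ (sym v≡u)
  ReflEq-sym (inj₂ v≡reverse-u) = inj₂ (sym (reverse-reverse (sym v≡reverse-u)))

  ReflEq? : DecidableEquality A → ∀ {n} → Decidable (ReflEq {A} {n})
  ReflEq? _≟_ u v = ≡-dec _≟_ v u ⊎-dec ≡-dec _≟_ v (reverse u)

  PairwiseReflDistinct : ∀ {n c} → Vec (Vec A n) c → Set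
  PairwiseReflDistinct ws = ∀ j j′ → j ≢ j′ → ¬ ReflEq (lookup ws j) (lookup ws j′)

  record ReflRepresentatives {n} (f : ℕ → Vec A n) (M : ℕ) : Set where
    field
      count    : ℕ
      words    : Vec (Vec A n) count
      attained : ∀ j → ∃ λ q → f q ≡ lookup words j
      distinct : PairwiseReflDistinct words
      covers   : ∀ q → q < M → ∃ λ j → ReflEq (f q) (lookup words j)

  reflRepresentatives : DecidableEquality A → ∀ {n} (f : ℕ → Vec A n) M → ReflRepresentatives f M
  reflRepresentatives _≟_ f zero = record
    { count = 0 ; words = [] ; attained = λ () ; distinct = λ () ; covers = λ _ () }
  reflRepresentatives _≟_ f (suc M) with reflRepresentatives _≟_ f M
  ... | R with any? (λ j → ReflEq? _≟_ (f M) (lookup (ReflRepresentatives.words R) j))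
  ...   | yes fM∼ = record
    { count = count ; words = words ; attained = attained ; distinct = distinct ; covers = covers′ }
    where
    open ReflRepresentatives R
    covers′ : ∀ q → q < suc M → ∃ λ j → ReflEq (f q) (lookup words j)
    covers′ q q<1+M with m<1+n⇒m<n∨m≡n q<1+M
    ... | inj₁ q<M  = covers q q<M
    ... | inj₂ refl = fM∼
  ...   | no fM≁ = record
    { count = suc count ; words = f M ∷ words ; attained = attained′ ; distinct = distinct′ ; covers = covers′ }
    where
    open ReflRepresentatives R
    attained′ : ∀ j → ∃ λ q → f q ≡ lookup (f M ∷ words) j
    attained′ Fin.zero    = M , refl
    attained′ (Fin.suc j) = attained j
    distinct′ : PairwiseReflDistinct (f M ∷ words)
    distinct′ Fin.zero    Fin.zero     0≢0 _ = 0≢0 refl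
    distinct′ Fin.zero    (Fin.suc j′) _   ∼ = fM≁ (j′ , ∼)
    distinct′ (Fin.suc j) Fin.zero     _   ∼ = fM≁ (j , ReflEq-sym ∼)
    distinct′ (Fin.suc j) (Fin.suc j′) j≢j′  = distinct j j′ (j≢j′ ∘ cong Fin.suc)
    covers′ : ∀ q → q < suc M → ∃ λ j → ReflEq (f q) (lookup (f M ∷ words) j)
    covers′ q q<1+M with m<1+n⇒m<n∨m≡n q<1+M
    ... | inj₁ q<M  = let j , ∼ = covers q q<M in Fin.suc j , ∼
    ... | inj₂ refl = Fin.zero , ReflEq-refl

  module _ {n c} (ws : Vec (Vec A n) c) where
    orientation : ∀ {w} → (∃ λ j → ReflEq w (lookup ws j)) → Fin c ⊎ Fin c
    orientation (j , inj₁ _) = inj₁ j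
    orientation (j , inj₂ _) = inj₂ j

    orientation-injective : ∀ {w w′} (r : ∃ λ j → ReflEq w (lookup ws j)) (r′ : ∃ λ j → ReflEq w′ (lookup ws j)) →
                            orientation r ≡ orientation r′ → w ≡ w′
    orientation-injective (j , inj₁ e) (j , inj₁ e′) refl = trans (sym e) e′
    orientation-injective (j , inj₂ e) (j , inj₂ e′) refl = reverse-injective (trans (sym e) e′)

module _ {k} (x : Seq k) where
  Agree : ℕ → ℕ → ℕ → Set
  Agree n a b = ∀ t → t < n → x (a + t) ≡ x (b + t)

  Mirror : ℕ → ℕ → ℕ → Set
  Mirror n a b = ∀ t s → suc (t + s) ≡ n → x (a + t) ≡ x (b + s)

  ReflEqAt : ℕ → ℕ → ℕ → Set
  ReflEqAt n a b = Agree n a b ⊎ Mirror n a b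

  Agree-restrict : ∀ {n n′ a b} → n ≤ n′ → Agree n′ a b → Agree n a b
  Agree-restrict n≤n′ e t t<n = e t (≤-trans t<n n≤n′)

  Mirror-sym : ∀ {n a b} → Mirror n a b → Mirror n b a
  Mirror-sym r t s 1+t+s≡n = sym (r s t (trans (cong suc (+-comm s t)) 1+t+s≡n))

  ReflEqAt-sym : ∀ {n a b} → ReflEqAt n a b → ReflEqAt n b a
  ReflEqAt-sym (inj₁ e) = inj₁ (λ t t<n → sym (e t t<n))
  ReflEqAt-sym (inj₂ r) = inj₂ (Mirror-sym r)

  Agree-suc : ∀ {n a b} → Agree n a b → x (a + n) ≡ x (b + n) → Agree (suc n) a b
  Agree-suc {n} agree new t t<1+n with m<1+n⇒m<n∨m≡n t<1+n
  ... | inj₁ t<n  = agree t t<n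
  ... | inj₂ refl = new

  ReflEqAt-comm : ∀ {n a b} → ReflEqAt n a b ⇔ ReflEqAt n b a
  ReflEqAt-comm = mk⇔ ReflEqAt-sym ReflEqAt-sym

  lookup-factorAt : ∀ {a n} (i : Fin n) → lookup (factorAt x a n) i ≡ x (a + toℕ i)
  lookup-factorAt {a} = lookup∘tabulate (λ i → x (a + toℕ i))

  lookup-factorAt-fromℕ< : ∀ {a n t} (t<n : t < n) → lookup (factorAt x a n) (fromℕ< t<n) ≡ x (a + t)
  lookup-factorAt-fromℕ< {a} t<n = trans (lookup-factorAt (fromℕ< t<n)) (cong (λ i → x (a + i)) (toℕ-fromℕ< t<n))

  factorAt-≡⇔Agree : ∀ {n a b} → factorAt x b n ≡ factorAt x a n ⇔ Agree n a b
  factorAt-≡⇔Agree {n} {a} {b} = mk⇔ to from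
    where
    to : factorAt x b n ≡ factorAt x a n → Agree n a b
    to eq t t<n = begin
      x (a + t)                                 ≡⟨ lookup-factorAt-fromℕ< t<n ⟨
      lookup (factorAt x a n) (fromℕ< t<n)      ≡⟨ cong (λ w → lookup w (fromℕ< t<n)) eq ⟨
      lookup (factorAt x b n) (fromℕ< t<n)      ≡⟨ lookup-factorAt-fromℕ< t<n ⟩
      x (b + t)                                 ∎
      where open ≡-Reasoning
    from : Agree n a b → factorAt x b n ≡ factorAt x a n
    from e = tabulate-cong (λ i → sym (e (toℕ i) (toℕ<n i)))

  factorAt-≡-reverse⇔Mirror : ∀ {n a b} → factorAt x b n ≡ reverse (factorAt x a n) ⇔ Mirror n a b
  factorAt-≡-reverse⇔Mirror {n} {a} {b} = mk⇔ to from
    where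
    lookup-reverse-factorAt : ∀ i → lookup (reverse (factorAt x a n)) i ≡ x (a + (n ∸ suc (toℕ i)))
    lookup-reverse-factorAt i = begin
      lookup (reverse (factorAt x a n)) i       ≡⟨ lookup-reverse (factorAt x a n) i ⟩
      lookup (factorAt x a n) (opposite i)      ≡⟨ lookup-factorAt (opposite i) ⟩
      x (a + toℕ (opposite i))                  ≡⟨ cong (λ j → x (a + j)) (opposite-prop i) ⟩
      x (a + (n ∸ suc (toℕ i)))                 ∎
      where open ≡-Reasoning
    to : factorAt x b n ≡ reverse (factorAt x a n) → Mirror n a b
    to eq t s 1+t+s≡n = begin
      x (a + t)                                 ≡⟨ cong (λ j → x (a + j)) t≡n∸1+s ⟩
      x (a + (n ∸ suc s))                       ≡⟨ cong (λ j → x (a + (n ∸ suc j))) (toℕ-fromℕ< s<n) ⟨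
      x (a + (n ∸ suc (toℕ (fromℕ< s<n))))      ≡⟨ lookup-reverse-factorAt (fromℕ< s<n) ⟨
      lookup (reverse (factorAt x a n)) (fromℕ< s<n) ≡⟨ cong (λ w → lookup w (fromℕ< s<n)) eq ⟨
      lookup (factorAt x b n) (fromℕ< s<n)      ≡⟨ lookup-factorAt-fromℕ< s<n ⟩
      x (b + s)                                 ∎
      where
      open ≡-Reasoning
      s<n : s < n
      s<n = subst (s <_) 1+t+s≡n (s≤s (m≤n+m s t))
      t≡n∸1+s : t ≡ n ∸ suc s
      t≡n∸1+s = sym (trans (cong (_∸ suc s) (sym 1+t+s≡n)) (m+n∸n≡m t s))
    from : Mirror n a b → factorAt x b n ≡ reverse (factorAt x a n)
    from r = trans (tabulate-cong mirrored) (tabulate∘lookup (reverse (factorAt x a n)))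
      where
      mirrored : ∀ i → x (b + toℕ i) ≡ lookup (reverse (factorAt x a n)) i
      mirrored i = sym (trans (lookup-reverse-factorAt i) (r _ (toℕ i) (trans (sym (+-suc _ (toℕ i))) (m∸n+n≡m (toℕ<n i)))))

  reflEq⇔ReflEqAt : ∀ {n a b} → ReflEq (factorAt x a n) (factorAt x b n) ⇔ ReflEqAt n a b
  reflEq⇔ReflEqAt = factorAt-≡⇔Agree ⊎-⇔ factorAt-≡-reverse⇔Mirror

  reflComplexity-transfer : ∀ {n n′ c} (φ : ℕ → ℕ) →
    (∀ i → ∃ λ s → factorAt x i n′ ≡ factorAt x (φ s) n′) →
    (∀ a b → ReflEqAt n a b ⇔ ReflEqAt n′ (φ a) (φ b)) →
    HasReflComplexity x n c → HasReflComplexity x n′ c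
  reflComplexity-transfer {n} {n′} {c} φ reach preserve (ws , factor , distinct , cover) =
    ws′ , factor′ , distinct′ , cover′
    where
    start : Fin c → ℕ
    start j = proj₁ (factor j)
    ws′ : Vec (Vec (Fin k) n′) c
    ws′ = tabulate (λ j → factorAt x (φ (start j)) n′)
    lookup-ws′ : ∀ j → lookup ws′ j ≡ factorAt x (φ (start j)) n′
    lookup-ws′ = lookup∘tabulate (λ j → factorAt x (φ (start j)) n′)
    preserve′ : ∀ a b → ReflEq (factorAt x a n) (factorAt x b n) ⇔ ReflEq (factorAt x (φ a) n′) (factorAt x (φ b) n′)
    preserve′ a b = ⇔.trans reflEq⇔ReflEqAt (⇔.trans (preserve a b) (⇔.sym reflEq⇔ReflEqAt))
    factor′ : ∀ j → IsFactor x (lookup ws′ j)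
    factor′ j = φ (start j) , sym (lookup-ws′ j)
    distinct′ : PairwiseReflDistinct ws′
    distinct′ j j′ j≢j′ ∼ = distinct j j′ j≢j′
      (subst₂ ReflEq (proj₂ (factor j)) (proj₂ (factor j′))
        (Equivalence.from (preserve′ (start j) (start j′)) (subst₂ ReflEq (lookup-ws′ j) (lookup-ws′ j′) ∼)))
    cover′ : ∀ i → ∃ λ j → ReflEq (factorAt x i n′) (lookup ws′ j)
    cover′ i with reach i
    ... | s , same with cover s
    ...   | j , ∼ = j , subst₂ ReflEq (sym same) (sym (lookup-ws′ j))
                          (Equivalence.to (preserve′ s (start j)) (subst (ReflEq _) (sym (proj₂ (factor j))) ∼))

  reflComplexity⇒repetition : ∀ {n c} → HasReflComplexity x n c → ∃₂ λ i d → i + suc d ≤ c + c × Agree n i (i + suc d)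
  reflComplexity⇒repetition {n} {c} (ws , _ , _ , cover)
    with pigeonhole (n<1+n (c + c)) (join c c ∘ orientation ws ∘ cover ∘ toℕ)
  ... | q , q′ , q<q′ , same-tag with m≤n⇒∃[o]m+o≡n q<q′
  ...   | d , 1+q+d≡q′ = toℕ q , d , bound , agree
    where
    q+1+d≡q′ : toℕ q + suc d ≡ toℕ q′
    q+1+d≡q′ = trans (+-suc (toℕ q) d) 1+q+d≡q′
    bound : toℕ q + suc d ≤ c + c
    bound = subst (_≤ c + c) (sym q+1+d≡q′) (s≤s⁻¹ (toℕ<n q′))
    same-orientation : orientation ws (cover (toℕ q′)) ≡ orientation ws (cover (toℕ q))
    same-orientation = trans (sym (splitAt-join c c _)) (trans (cong (splitAt c) (sym same-tag)) (splitAt-join c c _))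
    agree : Agree n (toℕ q) (toℕ q + suc d)
    agree = subst (Agree n (toℕ q)) (sym q+1+d≡q′)
      (Equivalence.to factorAt-≡⇔Agree (orientation-injective ws (cover (toℕ q′)) (cover (toℕ q)) same-orientation))

PeriodicFrom : ∀ {k} → Seq k → ℕ → ℕ → Set
PeriodicFrom x m P = ∀ i → m ≤ i → x (i + P) ≡ x i

module _ {A : Set} {m p} (u : Vec A m) (v : Vec A (suc p)) where
  uvω-≥ : ∀ {i} → m ≤ i → uvω u v i ≡ lookup v ((i ∸ m) mod suc p)
  uvω-≥ {i} m≤i with i <? m
  ... | yes i<m = ⊥-elim (<⇒≱ i<m m≤i)
  ... | no  _   = refl

module _ {k} {x : Seq k} where
  eventuallyPeriodic⇒periodicFrom : EventuallyPeriodic x → ∃₂ λ m p → PeriodicFrom x m (suc p)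
  eventuallyPeriodic⇒periodicFrom (m , p , u , v , x≡uvω) = m , p , periodic
    where
    periodic : PeriodicFrom x m (suc p)
    periodic i m≤i = begin
      x (i + suc p)                             ≡⟨ x≡uvω (i + suc p) ⟩
      uvω u v (i + suc p)                       ≡⟨ uvω-≥ u v (≤-trans m≤i (m≤m+n i (suc p))) ⟩
      lookup v ((i + suc p ∸ m) mod suc p)      ≡⟨ cong (λ j → lookup v (j mod suc p)) (+-∸-comm (suc p) m≤i) ⟩
      lookup v ((i ∸ m + suc p) mod suc p)      ≡⟨ cong (lookup v) (fromℕ<-cong _ _ ([m+n]%n≡m%n (i ∸ m) (suc p)) _ _) ⟩
      lookup v ((i ∸ m) mod suc p)              ≡⟨ uvω-≥ u v m≤i ⟨
      uvω u v i                                 ≡⟨ x≡uvω i ⟨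
      x i                                       ∎
      where open ≡-Reasoning

  periodicFrom-+* : ∀ {m P} → PeriodicFrom x m P → ∀ {i} → m ≤ i → ∀ q → x (i + q * P) ≡ x i
  periodicFrom-+* periodic {i} m≤i zero        = cong x (+-identityʳ i)
  periodicFrom-+* {m} {P} periodic {i} m≤i (suc q) = begin
    x (i + (P + q * P))                         ≡⟨ cong x (solve (i ∷ P ∷ q ∷ [])) ⟩
    x (i + q * P + P)                           ≡⟨ periodic (i + q * P) (≤-trans m≤i (m≤m+n i (q * P))) ⟩
    x (i + q * P)                               ≡⟨ periodicFrom-+* periodic m≤i q ⟩
    x i                                         ∎
    where open ≡-Reasoning

  periodicFrom-reduce : ∀ {m p} → PeriodicFrom x m (suc p) → ∀ {i} → m ≤ i →
                        ∀ j → x (i + j) ≡ x (m + (i ∸ m) % suc p + j)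
  periodicFrom-reduce {m} {p} periodic {i} m≤i j = begin
    x (i + j)                                   ≡⟨ cong (λ l → x (l + j)) (m+[n∸m]≡n m≤i) ⟨
    x (m + r + j)                               ≡⟨ cong (λ l → x (m + l + j)) (m≡m%n+[m/n]*n r (suc p)) ⟩
    x (m + (r % suc p + r / suc p * suc p) + j) ≡⟨ cong x (regroup m (r % suc p) (r / suc p * suc p) j) ⟩
    x (m + r % suc p + j + r / suc p * suc p)   ≡⟨ periodicFrom-+* periodic (≤-trans (m≤m+n m _) (m≤m+n _ j)) (r / suc p) ⟩
    x (m + r % suc p + j)                       ∎
    where
    open ≡-Reasoning
    r = i ∸ m
    regroup : ∀ a b c d → a + (b + c) + d ≡ a + b + d + c
    regroup a b c d = solve (a ∷ b ∷ c ∷ d ∷ [])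

  periodicFrom⇒eventuallyPeriodic : ∀ {m p} → PeriodicFrom x m (suc p) → EventuallyPeriodic x
  periodicFrom⇒eventuallyPeriodic {m} {p} periodic = m , p , u , v , x≡uvω
    where
    u : Vec (Fin k) m
    u = tabulate (x ∘ toℕ)
    v : Vec (Fin k) (suc p)
    v = tabulate (λ j → x (m + toℕ j))
    x≡uvω : ∀ i → x i ≡ uvω u v i
    x≡uvω i with i <? m
    ... | yes i<m = sym (trans (lookup∘tabulate (x ∘ toℕ) (fromℕ< i<m)) (cong x (toℕ-fromℕ< i<m)))
    ... | no  i≮m = begin
      x i                                       ≡⟨ cong x (+-identityʳ i) ⟨
      x (i + 0)                                 ≡⟨ periodicFrom-reduce periodic (≮⇒≥ i≮m) 0 ⟩
      x (m + (i ∸ m) % suc p + 0)               ≡⟨ cong x (+-identityʳ _) ⟩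
      x (m + (i ∸ m) % suc p)                   ≡⟨ cong (λ j → x (m + j)) (toℕ-fromℕ< _) ⟨
      x (m + toℕ ((i ∸ m) mod suc p))           ≡⟨ lookup∘tabulate (λ j → x (m + toℕ j)) _ ⟨
      lookup v ((i ∸ m) mod suc p)              ∎
      where open ≡-Reasoning

  suffix-representative : ∀ {m p} → PeriodicFrom x m (suc p) →
                          ∀ i → ∃ λ i′ → i′ < m + suc p × ∀ j → x (i + j) ≡ x (i′ + j)
  suffix-representative {m} {p} periodic i with i <? m
  ... | yes i<m = i , ≤-trans i<m (m≤m+n m (suc p)) , λ _ → refl
  ... | no  i≮m = m + (i ∸ m) % suc p , +-monoʳ-< m (m%n<n (i ∸ m) (suc p)) , periodicFrom-reduce periodic (≮⇒≥ i≮m)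

  least-preperiod : ∀ {m P} → PeriodicFrom x m P →
                    ∃ λ m′ → PeriodicFrom x m′ P × (∀ i → i < m′ → ¬ PeriodicFrom x i P)
  least-preperiod {zero}  periodic = zero , periodic , λ _ ()
  least-preperiod {suc q} {P} periodic with x (q + P) ≟ᶠ x q
  ... | yes x[q+P]≡x[q] = least-preperiod periodic′
    where
    periodic′ : PeriodicFrom x q P
    periodic′ i q≤i with m≤n⇒m<n∨m≡n q≤i
    ... | inj₁ q<i  = periodic i q<i
    ... | inj₂ refl = x[q+P]≡x[q]
  ... | no x[q+P]≢x[q] = suc q , periodic , λ i i<1+q periodic-i → x[q+P]≢x[q] (periodic-i q (s≤s⁻¹ i<1+q))

  periodicFrom-downward : ∀ {m a P} → PeriodicFrom x m P →
                          (∀ t → a + t < m → x (a + t + P) ≡ x (a + t)) → PeriodicFrom x a P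
  periodicFrom-downward {m} {a} periodic below i a≤i with m≤n⇒∃[o]m+o≡n a≤i
  ... | t , refl with a + t <? m
  ...   | yes a+t<m = below t a+t<m
  ...   | no  a+t≮m = periodic (a + t) (≮⇒≥ a+t≮m)

module EventuallyPeriodicSeq {k} (x : Seq k) {m p} (periodic : PeriodicFrom x m (suc p))
                            (least : ∀ i → i < m → ¬ PeriodicFrom x i (suc p)) where
  open ≡-Reasoning

  T : ℕ
  T = m + (m + suc p)

  m+1+p≤T : m + suc p ≤ T
  m+1+p≤T = m≤n+m (m + suc p) m

  period-back : ∀ {a} → m ≤ a → ∀ t → x (a + p + suc t) ≡ x (a + t)
  period-back {a} m≤a t = begin
    x (a + p + suc t)                           ≡⟨ cong x (solve (a ∷ p ∷ t ∷ [])) ⟩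
    x (a + t + suc p)                           ≡⟨ periodic (a + t) (≤-trans m≤a (m≤m+n a t)) ⟩
    x (a + t)                                   ∎

  agree-forever : ∀ {n a b} → m + suc p ≤ n → Agree x n a b → ∀ t → x (a + t) ≡ x (b + t)
  agree-forever {n} {a} {b} m+1+p≤n agree t with suffix-representative periodic t
  ... | t′ , t′<m+1+p , same = begin
    x (a + t)                                   ≡⟨ cong x (+-comm a t) ⟩
    x (t + a)                                   ≡⟨ same a ⟩
    x (t′ + a)                                  ≡⟨ cong x (+-comm t′ a) ⟩
    x (a + t′)                                  ≡⟨ agree t′ (≤-trans t′<m+1+p m+1+p≤n) ⟩
    x (b + t′)                                  ≡⟨ cong x (+-comm b t′) ⟩
    x (t′ + b)                                  ≡⟨ same b ⟨
    x (t + b)                                   ≡⟨ cong x (+-comm t b) ⟩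
    x (b + t)                                   ∎

  preperiodic-not-agreeing : ∀ {n a b} → a < m → m ≤ b → m + suc p ≤ n → ¬ Agree x n a b
  preperiodic-not-agreeing {n} {a} {b} a<m m≤b m+1+p≤n agree = least a a<m (periodicFrom-downward periodic below)
    where
    below : ∀ t → a + t < m → x (a + t + suc p) ≡ x (a + t)
    below t a+t<m = begin
      x (a + t + suc p)                         ≡⟨ cong x (+-assoc a t (suc p)) ⟩
      x (a + (t + suc p))                       ≡⟨ agree (t + suc p) (≤-trans (+-monoˡ-< (suc p) t<m) m+1+p≤n) ⟩
      x (b + (t + suc p))                       ≡⟨ cong x (+-assoc b t (suc p)) ⟨
      x (b + t + suc p)                         ≡⟨ periodic (b + t) (≤-trans m≤b (m≤m+n b t)) ⟩
      x (b + t)                                 ≡⟨ agree t (≤-trans t<m (≤-trans (m≤m+n m (suc p)) m+1+p≤n)) ⟨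
      x (a + t)                                 ∎
      where
      t<m : t < m
      t<m = ≤-trans (s≤s (m≤n+m t a)) a+t<m

  preperiodic-not-mirrored : ∀ {n a b} → a < m → T ≤ n → ¬ Mirror x n a b
  preperiodic-not-mirrored {n} {a} {b} a<m T≤n mirror = least a a<m (periodicFrom-downward periodic below)
    where
    below : ∀ t → a + t < m → x (a + t + suc p) ≡ x (a + t)
    below t a+t<m with m≤n⇒∃[o]m+o≡n 1+t+1+p+m≤n
      where
      1+t+1+p+m≤n : suc (t + suc p) + m ≤ n
      1+t+1+p+m≤n = ≤-trans (≤-trans (+-monoˡ-≤ m (+-monoˡ-≤ (suc p) (≤-trans (s≤s (m≤n+m t a)) a+t<m)))
                              (≤-reflexive (+-comm (m + suc p) m)))
                     T≤n
    ... | o , refl = begin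
      x (a + t + suc p)                         ≡⟨ cong x (+-assoc a t (suc p)) ⟩
      x (a + (t + suc p))                       ≡⟨ mirror (t + suc p) (m + o) (cong suc (solve (t ∷ p ∷ m ∷ o ∷ []))) ⟩
      x (b + (m + o))                           ≡⟨ periodic (b + (m + o)) (≤-trans (m≤m+n m o) (m≤n+m (m + o) b)) ⟨
      x (b + (m + o) + suc p)                   ≡⟨ cong x (+-assoc b (m + o) (suc p)) ⟩
      x (b + (m + o + suc p))                   ≡⟨ mirror t (m + o + suc p) (cong suc (solve (t ∷ p ∷ m ∷ o ∷ []))) ⟨
      x (a + t)                                 ∎

  preperiodic-isolated : ∀ {n a b} → a < m → m ≤ b → T ≤ n → ¬ ReflEqAt x n a b
  preperiodic-isolated a<m m≤b T≤n (inj₁ agree)  = preperiodic-not-agreeing a<m m≤b (≤-trans m+1+p≤T T≤n) agree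
  preperiodic-isolated a<m m≤b T≤n (inj₂ mirror) = preperiodic-not-mirrored a<m T≤n mirror

  preperiodic-lengthen : ∀ {n a b} → a < m → T ≤ n → ReflEqAt x n a b ⇔ ReflEqAt x (2 + n) a b
  preperiodic-lengthen {n} a<m T≤n = mk⇔
    [ (λ agree → inj₁ (λ t _ → agree-forever (≤-trans m+1+p≤T T≤n) agree t))
    , ⊥-elim ∘ preperiodic-not-mirrored a<m T≤n ]
    [ (λ agree → inj₁ (Agree-restrict x (m≤n+m n 2) agree))
    , ⊥-elim ∘ preperiodic-not-mirrored a<m (≤-trans T≤n (m≤n+m n 2)) ]

  agree-shift : ∀ {n a b} → m ≤ a → m ≤ b → T ≤ n → Agree x n a b ⇔ Agree x (2 + n) (a + p) (b + p)
  agree-shift {n} {a} {b} m≤a m≤b T≤n = mk⇔ to from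
    where
    to : Agree x n a b → Agree x (2 + n) (a + p) (b + p)
    to agree t _ = begin
      x (a + p + t)                             ≡⟨ cong x (+-assoc a p t) ⟩
      x (a + (p + t))                           ≡⟨ agree-forever (≤-trans m+1+p≤T T≤n) agree (p + t) ⟩
      x (b + (p + t))                           ≡⟨ cong x (+-assoc b p t) ⟨
      x (b + p + t)                             ∎
    from : Agree x (2 + n) (a + p) (b + p) → Agree x n a b
    from agree t t<n = begin
      x (a + t)                                 ≡⟨ period-back m≤a t ⟨
      x (a + p + suc t)                         ≡⟨ agree (suc t) (s≤s (m≤n⇒m≤1+n t<n)) ⟩
      x (b + p + suc t)                         ≡⟨ period-back m≤b t ⟩
      x (b + t)                                 ∎

  mirror-endpoint : ∀ {n a b} → m ≤ b → suc p ≤ n → Mirror x n a b → x (a + p) ≡ x (b + p + suc n)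
  mirror-endpoint {n} {a} {b} m≤b 1+p≤n mirror with m≤n⇒∃[o]m+o≡n 1+p≤n
  ... | o , refl = begin
    x (a + p)                                   ≡⟨ mirror p o refl ⟩
    x (b + o)                                   ≡⟨ periodic (b + o) m≤b+o ⟨
    x (b + o + suc p)                           ≡⟨ periodic (b + o + suc p) (≤-trans m≤b+o (m≤m+n (b + o) (suc p))) ⟨
    x (b + o + suc p + suc p)                   ≡⟨ cong x (solve (b ∷ o ∷ p ∷ [])) ⟩
    x (b + p + suc (suc p + o))                 ∎
    where
    m≤b+o : m ≤ b + o
    m≤b+o = ≤-trans m≤b (m≤m+n b o)

  mirror-shift : ∀ {n a b} → m ≤ a → m ≤ b → T ≤ n → Mirror x n a b ⇔ Mirror x (2 + n) (a + p) (b + p)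
  mirror-shift {n} {a} {b} m≤a m≤b T≤n = mk⇔ to from
    where
    1+p≤n : suc p ≤ n
    1+p≤n = ≤-trans (m≤n+m (suc p) m) (≤-trans m+1+p≤T T≤n)
    to : Mirror x n a b → Mirror x (2 + n) (a + p) (b + p)
    to mirror zero s 1+s≡2+n with suc-injective 1+s≡2+n
    ... | refl = trans (cong x (+-identityʳ (a + p))) (mirror-endpoint m≤b 1+p≤n mirror)
    to mirror (suc t) zero 2+t+0≡2+n with trans (sym (+-identityʳ t)) (suc-injective (suc-injective 2+t+0≡2+n))
    ... | refl = sym (trans (cong x (+-identityʳ (b + p))) (mirror-endpoint m≤a 1+p≤n (Mirror-sym x mirror)))
    to mirror (suc t) (suc s) 2+t+1+s≡2+n = begin
      x (a + p + suc t)                         ≡⟨ period-back m≤a t ⟩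
      x (a + t)                                 ≡⟨ mirror t s (trans (sym (+-suc t s)) (suc-injective (suc-injective 2+t+1+s≡2+n))) ⟩
      x (b + s)                                 ≡⟨ period-back m≤b s ⟨
      x (b + p + suc s)                         ∎
    from : Mirror x (2 + n) (a + p) (b + p) → Mirror x n a b
    from mirror t s 1+t+s≡n = begin
      x (a + t)                                 ≡⟨ period-back m≤a t ⟨
      x (a + p + suc t)                         ≡⟨ mirror (suc t) (suc s) (cong (2 +_) (trans (+-suc t s) 1+t+s≡n)) ⟩
      x (b + p + suc s)                         ≡⟨ period-back m≤b s ⟩
      x (b + s)                                 ∎

  φ : ℕ → ℕ
  φ a with a <? m
  ... | yes _ = a
  ... | no  _ = a + p

  φ-< : ∀ {a} → a < m → φ a ≡ a
  φ-< {a} a<m with a <? m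
  ... | yes _   = refl
  ... | no  a≮m = ⊥-elim (a≮m a<m)

  φ-≥ : ∀ {a} → m ≤ a → φ a ≡ a + p
  φ-≥ {a} m≤a with a <? m
  ... | yes a<m = ⊥-elim (<⇒≱ a<m m≤a)
  ... | no  _   = refl

  reach : ∀ {n} i → ∃ λ s → factorAt x i n ≡ factorAt x (φ s) n
  reach {n} i with i <? m
  ... | yes i<m = i , cong (λ a → factorAt x a n) (sym (φ-< i<m))
  ... | no  i≮m = suc i , trans (tabulate-cong (one-period-on ∘ toℕ))
                                 (cong (λ a → factorAt x a n) (sym (φ-≥ (m≤n⇒m≤1+n m≤i))))
    where
    m≤i : m ≤ i
    m≤i = ≮⇒≥ i≮m
    one-period-on : ∀ t → x (i + t) ≡ x (suc i + p + t)
    one-period-on t = begin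
      x (i + t)                                 ≡⟨ period-back m≤i t ⟨
      x (i + p + suc t)                         ≡⟨ cong x (solve (i ∷ p ∷ t ∷ [])) ⟩
      x (suc i + p + t)                         ∎

  preperiodic-isolated-shift : ∀ {n a b} → a < m → m ≤ b → T ≤ n → ReflEqAt x n a b ⇔ ReflEqAt x (2 + n) a (b + p)
  preperiodic-isolated-shift {n} {b = b} a<m m≤b T≤n = mk⇔
    (⊥-elim ∘ preperiodic-isolated a<m m≤b T≤n)
    (⊥-elim ∘ preperiodic-isolated a<m (≤-trans m≤b (m≤m+n b p)) (≤-trans T≤n (m≤n+m n 2)))

  reflEqAt-shift : ∀ {n} → T ≤ n → ∀ a b → ReflEqAt x n a b ⇔ ReflEqAt x (2 + n) (φ a) (φ b)
  reflEqAt-shift {n} T≤n a b with a <? m | b <? m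
  ... | yes a<m | yes _   = preperiodic-lengthen a<m T≤n
  ... | yes a<m | no  b≮m = preperiodic-isolated-shift a<m (≮⇒≥ b≮m) T≤n
  ... | no  a≮m | yes b<m =
    ⇔.trans (ReflEqAt-comm x) (⇔.trans (preperiodic-isolated-shift b<m (≮⇒≥ a≮m) T≤n) (ReflEqAt-comm x))
  ... | no  a≮m | no  b≮m = agree-shift (≮⇒≥ a≮m) (≮⇒≥ b≮m) T≤n ⊎-⇔ mirror-shift (≮⇒≥ a≮m) (≮⇒≥ b≮m) T≤n

  reflComplexity-step : ∀ {n c} → T ≤ n → HasReflComplexity x n c → HasReflComplexity x (2 + n) c
  reflComplexity-step T≤n = reflComplexity-transfer x φ reach (reflEqAt-shift T≤n)

  reflComplexity-exists : ∀ n → ∃ (HasReflComplexity x n)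
  reflComplexity-exists n = count , words , attained , distinct , cover
    where
    open ReflRepresentatives (reflRepresentatives _≟ᶠ_ (λ q → factorAt x q n) (m + suc p))
    cover : ∀ i → ∃ λ j → ReflEq (factorAt x i n) (lookup words j)
    cover i with suffix-representative periodic i
    ... | i′ , i′<m+1+p , same = subst (λ w → ∃ λ j → ReflEq w (lookup words j))
                                       (tabulate-cong (sym ∘ same ∘ toℕ)) (covers i′ i′<m+1+p)

  reflComplexity-eventuallyConstant : (g : ℕ → ℕ) → (∀ n → g (suc n) ≡ 2 + g n) → (∀ n → n ≤ g n) →
                                      EventuallyConstantRC x g
  reflComplexity-eventuallyConstant g g-step g-inflationary with reflComplexity-exists (g T)
  ... | c , base = c , T , stable
    where
    stable : ∀ n → n ≥ T → HasReflComplexity x (g n) c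
    stable n T≤n with m≤n⇒m<n∨m≡n T≤n
    ... | inj₂ refl = base
    stable (suc n) _ | inj₁ (s≤s T≤n) = subst (λ l → HasReflComplexity x l c) (sym (g-step n))
                                          (reflComplexity-step (≤-trans T≤n (g-inflationary n)) (stable n T≤n))

module _ {k} {x : Seq k} where
  -- Writing n = i′ + (1 + d′) + r, the long repetition moves the positions i + n and
  -- i + P + n back by 1 + d′, to where the repetition of period P is already known.
  Agree-extend : ∀ {n i P i′ d′ L} → Agree x n i (i + P) → Agree x L i′ (i′ + suc d′) →
                 i′ + suc d′ ≤ n → i + P + n ≤ L → Agree x (suc n) i (i + P)
  Agree-extend {n} {i} {P} {i′} {d′} {L} agree agree′ i′+1+d′≤n i+P+n≤L with m≤n⇒∃[o]m+o≡n i′+1+d′≤n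
  ... | r , refl = Agree-suc x agree (begin
    x (i + (i′ + suc d′ + r))                   ≡⟨ cong x (solve (i ∷ i′ ∷ d′ ∷ r ∷ [])) ⟩
    x (i′ + suc d′ + (i + r))                   ≡⟨ agree′ (i + r) i+r<L ⟨
    x (i′ + (i + r))                            ≡⟨ cong x (solve (i′ ∷ i ∷ r ∷ [])) ⟩
    x (i + (i′ + r))                            ≡⟨ agree (i′ + r) (+-monoˡ-< r (m<m+n i′ z<s)) ⟩
    x (i + P + (i′ + r))                        ≡⟨ cong x (solve (i ∷ P ∷ i′ ∷ r ∷ [])) ⟩
    x (i′ + (i + P + r))                        ≡⟨ agree′ (i + P + r) i+P+r<L ⟩
    x (i′ + suc d′ + (i + P + r))               ≡⟨ cong x (solve (i′ ∷ d′ ∷ i ∷ P ∷ r ∷ [])) ⟩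
    x (i + P + (i′ + suc d′ + r))               ∎)
    where
    open ≡-Reasoning
    i+P+r<L : i + P + r < L
    i+P+r<L = <-≤-trans (+-monoʳ-< (i + P) (m<n+m r (≤-trans z<s (m≤n+m (suc d′) i′)))) i+P+n≤L
    i+r<L : i + r < L
    i+r<L = ≤-<-trans (+-monoˡ-≤ r (m≤m+n i P)) i+P+r<L

  bounded-repetitions⇒eventuallyPeriodic : ∀ C → (∀ L → ∃₂ λ i d → i + suc d ≤ C × Agree x L i (i + suc d)) →
                                           EventuallyPeriodic x
  bounded-repetitions⇒eventuallyPeriodic C repetitions with repetitions C
  ... | i , d , i+1+d≤C , agree-C = periodicFrom⇒eventuallyPeriodic periodic
    where
    agree : ∀ n → Agree x n i (i + suc d)
    agree zero = λ _ ()
    agree (suc n) with n <? C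
    ... | yes n<C = Agree-restrict x n<C agree-C
    ... | no  n≮C with repetitions (C + n)
    ...   | i′ , d′ , i′+1+d′≤C , agree′ =
      Agree-extend (agree n) agree′ (≤-trans i′+1+d′≤C (≮⇒≥ n≮C)) (+-monoˡ-≤ n i+1+d≤C)
    periodic : PeriodicFrom x i (suc d)
    periodic j i≤j with m≤n⇒∃[o]m+o≡n i≤j
    ... | t , refl = begin
      x (i + t + suc d)                         ≡⟨ cong x (solve (i ∷ t ∷ d ∷ [])) ⟩
      x (i + suc d + t)                         ≡⟨ agree (suc t) t (n<1+n t) ⟨
      x (i + t)                                 ∎
      where open ≡-Reasoning

  eventuallyPeriodic⇒eventuallyConstant : EventuallyPeriodic x →
    EventuallyConstantRC x (λ n → 2 * n) × EventuallyConstantRC x (λ n → suc (2 * n))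
  eventuallyPeriodic⇒eventuallyConstant eventuallyPeriodic
    with eventuallyPeriodic⇒periodicFrom eventuallyPeriodic
  ... | _ , _ , periodic₀ with least-preperiod periodic₀
  ...   | _ , periodic , least =
    reflComplexity-eventuallyConstant (λ n → 2 * n) double-suc (λ n → m≤m+n n (n + 0)) ,
    reflComplexity-eventuallyConstant (λ n → suc (2 * n)) (cong suc ∘ double-suc) (λ n → m≤n⇒m≤1+n (m≤m+n n (n + 0)))
    where
    open EventuallyPeriodicSeq x periodic least
    double-suc : ∀ n → 2 * suc n ≡ 2 + 2 * n
    double-suc = *-distribˡ-+ 2 1

  eventuallyConstantEven⇒eventuallyPeriodic : EventuallyConstantRC x (λ n → 2 * n) → EventuallyPeriodic x
  eventuallyConstantEven⇒eventuallyPeriodic (c , N , constant) =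
    bounded-repetitions⇒eventuallyPeriodic (c + c) repetitions
    where
    repetitions : ∀ L → ∃₂ λ i d → i + suc d ≤ c + c × Agree x L i (i + suc d)
    repetitions L with reflComplexity⇒repetition x (constant (N + L) (m≤m+n N L))
    ... | i , d , i+1+d≤2c , agree = i , d , i+1+d≤2c , Agree-restrict x (≤-trans (m≤n+m L N) (m≤m+n (N + L) _)) agree

theorem5p1 : (k : ℕ) (x : Seq k) →
    (EventuallyPeriodic x →
      EventuallyConstantRC x (λ n → 2 * n) × EventuallyConstantRC x (λ n → suc (2 * n)))
    × (EventuallyConstantRC x (λ n → 2 * n) × EventuallyConstantRC x (λ n → suc (2 * n)) →
      EventuallyPeriodic x)
theorem5p1 _ x = eventuallyPeriodic⇒eventuallyConstant , eventuallyConstantEven⇒eventuallyPeriodic ∘ proj₁
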